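{- Let $k\geq 1$, let $P_{2k+1}$ be the path with vertices $u_1,\dots,u_{2k+1}$ (in this order), and let $a,b\in\{1,\dots,2k+1\}$. Let $H_1,\dots,H_{2k+1}$ be graphs with $n$ vertices each. Assume that $P_{2k+1}[H_1,\dots,H_{2k+1}]$ contains a hamiltonian path starting at a vertex $x$ of the copy of $H_a$ and ending at a vertex $y$ of the copy of $H_b$. (I) If $a,b$ are both even, then $\sum_{i=0}^k\pi(H_{2i+1})\geq n+1$. (II) If $a$ is odd and $b$ is even, then $\sum_{i=0}^k\pi(H_{2i+1})\geq n$. (III) If $a,b$ are both odd, then $\sum_{i=0}^k\pi(H_{2i+1})\geq n-1$.
   Context: Generalized lexicographic product: for a graph $G$ with $V(G)=\{u_1,\dots,u_m\}$ and graphs $H_1,\dots,H_m$ each on $n$ vertices, $G[H_1,\dots,H_m]$ is obtained from $G$ by replacing each vertex $u_i$ with a copy of $H_i$ (keeping the edges of $H_i$) and adding all edges between the copies of $H_i$ and $H_j$ whenever $u_iu_j\in E(G)$. For a graph $H$, $\pi(H)$ denotes the maximum number of edges of a spanning linear forest of $H$ (a forest all of whose components are paths). -}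

module Defs where

open import Data.Nat using (ℕ; zero; suc; _+_; _∸_; _≤_)
open import Data.Fin using (Fin; zero; suc; toℕ)
open import Data.Product using (Σ; _×_; _,_; ∃-syntax)
open import Data.Sum using (_⊎_)
open import Data.Bool using (Bool; true; false)
open import Data.Empty using (⊥)
open import Data.Unit using (⊤)
open import Data.List using (List; []; _∷_; length; concat; map; allFin; head; last)
open import Data.Nat.ListAction using (sum)
open import Data.List.Relation.Unary.All using (All)
open import Data.List.Relation.Unary.Linked using (Linked)
open import Data.List.Relation.Unary.Unique.Propositional using (Unique)
open import Data.List.Membership.Propositional using (_∈_)
open import Data.List.Relation.Binary.Permutation.Propositional using (_↭_)
open import Data.Maybe using (just)
open import Relation.Binary.PropositionalEquality using (_≡_)
open import Relation.Nullary using (¬_)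

record Graph (n : ℕ) : Set₁ where
  field
    Adj    : Fin n → Fin n → Set
    sym    : ∀ {u v} → Adj u v → Adj v u
    irrefl : ∀ {u} → ¬ Adj u u

open Graph public

Even : ℕ → Set
Even m = ∃[ j ] m ≡ j + j

Odd : ℕ → Set
Odd m = ∃[ j ] m ≡ suc (j + j)

NonEmpty : {V : Set} → List V → Set
NonEmpty []      = ⊥
NonEmpty (_ ∷ _) = ⊤

record SpanningLinearForest {n : ℕ} (H : Graph n) : Set where
  field
    paths    : List (List (Fin n))
    nonempty : All NonEmpty paths
    isPath   : All (Linked (Adj H)) paths
    spanning : concat paths ↭ allFin n

open SpanningLinearForest public

-- Number of edges of a linear forest (a path on ℓ vertices has ℓ - 1 edges).
edges : {n : ℕ} {H : Graph n} → SpanningLinearForest H → ℕ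
edges F = sum (map (λ p → length p ∸ 1) (paths F))

IsPi : {n : ℕ} → Graph n → ℕ → Set
IsPi H p = (∃[ F ] edges {H = H} F ≡ p) × (∀ (F : SpanningLinearForest H) → edges F ≤ p)

-- Vertex (i , v): vertex v of the copy of H_{i+1} (path vertex u_{i+1}).
LexVertex : ℕ → ℕ → Set
LexVertex m n = Fin m × Fin n

PathAdj : {m : ℕ} → Fin m → Fin m → Set
PathAdj i j = (toℕ j ≡ suc (toℕ i)) ⊎ (toℕ i ≡ suc (toℕ j))

LexAdj : {m n : ℕ} → (Fin m → Graph n) → LexVertex m n → LexVertex m n → Set
LexAdj Hs (i , v) (j , w) = ((i ≡ j) × Adj (Hs i) v w) ⊎ PathAdj i j

IsHamiltonianPath : {V : Set} → (V → V → Set) → V → V → List V → Set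
IsHamiltonianPath R x y ps =
  Linked R ps × Unique ps × (∀ z → z ∈ ps) × (head ps ≡ just x) × (last ps ≡ just y)

-- Σ_{i=0}^{k} f(2i) over Fin (2k+1), i.e. summing f over the indices i
-- (0-based) with i even, i.e. over u_1, u_3, …, u_{2k+1}.

sumAlt : Bool → (m : ℕ) → (Fin m → ℕ) → ℕ
sumAlt _     zero    f = 0
sumAlt true  (suc m) f = f zero + sumAlt false m (λ i → f (suc i))
sumAlt false (suc m) f = sumAlt true m (λ i → f (suc i))

sumOddPositions : (m : ℕ) → (Fin m → ℕ) → ℕ
sumOddPositions = sumAlt true

module Submission where

-- Call a vertex of the hamiltonian path odd if it lies in one of the copies
-- H₁, H₃, …, H_{2k+1}.  Odd positions of P_{2k+1} are pairwise non-adjacent, so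
-- a maximal run of consecutive odd vertices stays inside a single copy, and the
-- runs inside H_{2i+1} form a spanning linear forest of it; hence the number of
-- odd–odd steps of the path is at most Σ π(H_{2i+1}).  On the other hand the
-- path has (k+1)n odd and kn even vertices, and the even vertices cut the odd
-- ones into at most kn + 1 runs, one fewer for each end of the path lying in an
-- even copy.  Counting odd–odd steps as (odd vertices) − (runs) gives
-- Σ π(H_{2i+1}) ≥ n − 1 + [a even] + [b even].

open import Defs hiding (sym)
open import Data.Nat using (ℕ; zero; suc; _+_; _*_; _∸_; _≤_; z≤n; s≤s; s≤s⁻¹)
open import Data.Nat.Properties
  using ( suc-injective; 1+n≢n; +-suc; +-identityʳ; +-commutativeSemigroup
        ; ≤-refl; ≤-reflexive; ≤-trans; n≤1+n; +-mono-≤; +-monoˡ-≤; +-monoʳ-≤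
        ; +-cancelʳ-≤; ∸-monoˡ-≤; module ≤-Reasoning)
open import Algebra.Properties.CommutativeSemigroup +-commutativeSemigroup using (interchange)
open import Data.Nat.ListAction using (sum)
open import Data.Nat.Solver using (module +-*-Solver)
open import Data.Bool using (Bool; true; false; not; _∧_)
open import Data.Bool.Properties using (∧-idem; ∧-inverseˡ; ∧-inverseʳ; not-involutive)
open import Data.Fin using (Fin; zero; suc; toℕ)
open import Data.Fin.Properties using (_≟_)
open import Data.Maybe using (Maybe; just; nothing; is-just)
open import Data.Product using (_×_; _,_; proj₁; proj₂; ∃-syntax; map₁; uncurry)
open import Data.Sum using (inj₁; inj₂)
open import Data.Unit using (⊤; tt)
open import Data.Empty using (⊥-elim)
open import Data.List using (List; []; _∷_; _++_; length; map; concat; allFin; catMaybes; mapMaybe; last)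
open import Data.List.Properties using (length-tabulate)
open import Data.List.Relation.Unary.All as All using (All; []; _∷_)
open import Data.List.Relation.Unary.AllPairs using ([]; _∷_)
open import Data.List.Relation.Unary.Any using (here; there)
open import Data.List.Relation.Unary.Linked as Linked using (Linked; []; [-]; _∷_)
open import Data.List.Relation.Unary.Linked.Properties using () renaming (map⁺ to Linked-map⁺)
open import Data.List.Relation.Unary.Unique.Propositional using (Unique)
open import Data.List.Relation.Unary.Unique.Propositional.Properties using (allFin⁺)
open import Data.List.Membership.Propositional using (_∈_)
open import Data.List.Membership.Propositional.Properties using (∈-allFin)
open import Data.List.Membership.Propositional.Properties.WithK using (unique∧set⇒bag)
open import Data.List.Relation.Binary.BagAndSetEquality using (∼bag⇒↭)
open import Data.List.Relation.Binary.Permutation.Propositional using (_↭_)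
open import Data.List.Relation.Binary.Permutation.Propositional.Properties using (↭-length)
open import Function.Bundles using (mk⇔)
open import Relation.Nullary using (yes; no; does)
open import Relation.Binary.PropositionalEquality
  using (_≡_; _≢_; refl; sym; trans; cong; cong₂; subst; module ≡-Reasoning)

𝟙 : Bool → ℕ
𝟙 true  = 1
𝟙 false = 0

δ : Bool → Bool → ℕ
δ true  c = 𝟙 c
δ false c = 𝟙 (not c)

δ-not : ∀ b c → δ (not b) c ≡ δ b (not c)
δ-not true  c = refl
δ-not false c = cong 𝟙 (sym (not-involutive c))

count : Bool → List Bool → ℕ
count b []       = 0
count b (c ∷ cs) = δ b c + count b cs

trueSteps : List Bool → ℕ
trueSteps []           = 0
trueSteps (_ ∷ [])     = 0
trueSteps (b ∷ c ∷ cs) = 𝟙 (b ∧ c) + trueSteps (c ∷ cs)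

lastOr : {A : Set} → A → List A → A
lastOr x []       = x
lastOr _ (y ∷ ys) = lastOr y ys

lastOr-map : ∀ {A B : Set} (f : A → B) x xs {y} →
             last (x ∷ xs) ≡ just y → lastOr (f x) (map f xs) ≡ f y
lastOr-map f x []       refl = refl
lastOr-map f x (x′ ∷ xs) eq  = lastOr-map f x′ xs eq

count-true≤trueSteps+count-false : ∀ b bs →
  𝟙 (not b) + count true (b ∷ bs) + 𝟙 (not (lastOr b bs)) ≤
  suc (trueSteps (b ∷ bs) + count false (b ∷ bs))
count-true≤trueSteps+count-false true  []           = ≤-refl
count-true≤trueSteps+count-false false []           = ≤-refl
count-true≤trueSteps+count-false true  (true ∷ bs)  =
  s≤s (count-true≤trueSteps+count-false true bs)
count-true≤trueSteps+count-false true  (false ∷ bs) =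
  count-true≤trueSteps+count-false false bs
count-true≤trueSteps+count-false false (true ∷ bs)  =
  s≤s (≤-trans (count-true≤trueSteps+count-false true bs)
               (≤-reflexive (sym (+-suc (trueSteps (true ∷ bs)) _))))
count-true≤trueSteps+count-false false (false ∷ bs) =
  ≤-trans (count-true≤trueSteps+count-false false bs)
          (s≤s (+-monoʳ-≤ (trueSteps (false ∷ bs)) (n≤1+n _)))

-- oddPositionᵇ t holds iff t + 1 is odd: index t : Fin m stands for the
-- path vertex u_{t+1}, and sumAlt b m f sums f t over those t with
-- oddPositionᵇ (toℕ t) ≡ b.
oddPositionᵇ : ℕ → Bool
oddPositionᵇ zero    = true
oddPositionᵇ (suc t) = not (oddPositionᵇ t)

oddPositionᵇ-double : ∀ j → oddPositionᵇ (j + j) ≡ true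
oddPositionᵇ-double zero    = refl
oddPositionᵇ-double (suc j) rewrite +-suc j j =
  trans (not-involutive (oddPositionᵇ (j + j))) (oddPositionᵇ-double j)

Even-suc⇒oddPositionᵇ : ∀ {t} → Even (suc t) → oddPositionᵇ t ≡ false
Even-suc⇒oddPositionᵇ {t} (j , eq) = begin
  oddPositionᵇ t             ≡⟨ sym (not-involutive _) ⟩
  not (oddPositionᵇ (suc t)) ≡⟨ cong (λ s → not (oddPositionᵇ s)) eq ⟩
  not (oddPositionᵇ (j + j)) ≡⟨ cong not (oddPositionᵇ-double j) ⟩
  false                      ∎
  where open ≡-Reasoning

Odd-suc⇒oddPositionᵇ : ∀ {t} → Odd (suc t) → oddPositionᵇ t ≡ true
Odd-suc⇒oddPositionᵇ (j , eq) = trans (cong oddPositionᵇ (suc-injective eq)) (oddPositionᵇ-double j)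

PathAdj⇒opposite : ∀ {m} {c c′ : Fin m} → PathAdj c c′ →
                   oddPositionᵇ (toℕ c) ∧ oddPositionᵇ (toℕ c′) ≡ false
PathAdj⇒opposite {c = c} (inj₁ eq) rewrite eq = ∧-inverseʳ (oddPositionᵇ (toℕ c))
PathAdj⇒opposite {c′ = c′} (inj₂ eq) rewrite eq = ∧-inverseˡ (oddPositionᵇ (toℕ c′))

sumAlt-zero : ∀ b m → sumAlt b m (λ _ → 0) ≡ 0
sumAlt-zero b     zero    = refl
sumAlt-zero true  (suc m) = sumAlt-zero false m
sumAlt-zero false (suc m) = sumAlt-zero true m

sumAlt-cong : ∀ b m {f g : Fin m → ℕ} → (∀ i → f i ≡ g i) → sumAlt b m f ≡ sumAlt b m g
sumAlt-cong b     zero    f≡g = refl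
sumAlt-cong true  (suc m) f≡g = cong₂ _+_ (f≡g zero) (sumAlt-cong false m (λ i → f≡g (suc i)))
sumAlt-cong false (suc m) f≡g = sumAlt-cong true m (λ i → f≡g (suc i))

sumAlt-mono : ∀ b m {f g : Fin m → ℕ} → (∀ i → f i ≤ g i) → sumAlt b m f ≤ sumAlt b m g
sumAlt-mono b     zero    f≤g = z≤n
sumAlt-mono true  (suc m) f≤g = +-mono-≤ (f≤g zero) (sumAlt-mono false m (λ i → f≤g (suc i)))
sumAlt-mono false (suc m) f≤g = sumAlt-mono true m (λ i → f≤g (suc i))

sumAlt-+ : ∀ b m (f g : Fin m → ℕ) →
           sumAlt b m (λ i → f i + g i) ≡ sumAlt b m f + sumAlt b m g
sumAlt-+ b     zero    f g = refl
sumAlt-+ true  (suc m) f g =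
  trans (cong (f zero + g zero +_) (sumAlt-+ false m (λ i → f (suc i)) (λ i → g (suc i))))
        (interchange (f zero) (g zero) _ _)
sumAlt-+ false (suc m) f g = sumAlt-+ true m (λ i → f (suc i)) (λ i → g (suc i))

sumAlt-indicator : ∀ b m (c : Fin m) →
                   sumAlt b m (λ i → 𝟙 (does (c ≟ i))) ≡ δ b (oddPositionᵇ (toℕ c))
sumAlt-indicator true  (suc m) zero    = cong suc (sumAlt-zero false m)
sumAlt-indicator false (suc m) zero    = sumAlt-zero true m
sumAlt-indicator true  (suc m) (suc c) = trans (sumAlt-indicator false m c) (δ-not true _)
sumAlt-indicator false (suc m) (suc c) = trans (sumAlt-indicator true m c) (δ-not false _)

sumAlt-const-double : ∀ b j x → sumAlt b (j + j) (λ _ → x) ≡ j * x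
sumAlt-const-double b     zero    x = refl
sumAlt-const-double true  (suc j) x rewrite +-suc j j = cong (x +_) (sumAlt-const-double true j x)
sumAlt-const-double false (suc j) x rewrite +-suc j j = cong (x +_) (sumAlt-const-double false j x)

sumAlt-const-odd : ∀ k x →
  sumAlt true (suc (2 * k)) (λ _ → x) ≡ x + sumAlt false (suc (2 * k)) (λ _ → x)
sumAlt-const-odd k x rewrite +-identityʳ k =
  cong (x +_) (trans (sumAlt-const-double false k x) (sym (sumAlt-const-double true k x)))

module _ {A : Set} where

  OnJusts : (A → A → Set) → Maybe A → Maybe A → Set
  OnJusts R (just a) (just b) = R a b
  OnJusts R _        _        = ⊤

  adjacentJusts : List (Maybe A) → ℕ
  adjacentJusts []            = 0
  adjacentJusts (_ ∷ [])      = 0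
  adjacentJusts (w ∷ w′ ∷ ws) = 𝟙 (is-just w ∧ is-just w′) + adjacentJusts (w′ ∷ ws)

  adjacentJusts-nothing : ∀ ws → adjacentJusts (nothing ∷ ws) ≡ adjacentJusts ws
  adjacentJusts-nothing []       = refl
  adjacentJusts-nothing (_ ∷ ws) = refl

  consNonEmpty : List A → List (List A) → List (List A)
  consNonEmpty []      ss = ss
  consNonEmpty (a ∷ s) ss = (a ∷ s) ∷ ss

  -- The maximal blocks of consecutive justs: the first component is the block
  -- starting at the head (empty if the list starts with nothing).
  splitSegments : List (Maybe A) → List A × List (List A)
  splitSegments []             = [] , []
  splitSegments (just a ∷ ws)  = map₁ (a ∷_) (splitSegments ws)
  splitSegments (nothing ∷ ws) = [] , uncurry consNonEmpty (splitSegments ws)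

  segments : List (Maybe A) → List (List A)
  segments ws = uncurry consNonEmpty (splitSegments ws)

  segmentEdges : List (List A) → ℕ
  segmentEdges ss = sum (map (λ s → length s ∸ 1) ss)

  All-consNonEmpty : ∀ {P : List A → Set} s {ss} →
                     (NonEmpty s → P s) → All P ss → All P (consNonEmpty s ss)
  All-consNonEmpty []      ps pss = pss
  All-consNonEmpty (_ ∷ _) ps pss = ps tt ∷ pss

  concat-consNonEmpty : ∀ s ss → concat (consNonEmpty s ss) ≡ s ++ concat ss
  concat-consNonEmpty []      ss = refl
  concat-consNonEmpty (_ ∷ _) ss = refl

  segmentEdges-consNonEmpty : ∀ s ss →
    segmentEdges (consNonEmpty s ss) ≡ (length s ∸ 1) + segmentEdges ss
  segmentEdges-consNonEmpty []      ss = refl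
  segmentEdges-consNonEmpty (_ ∷ _) ss = refl

  concat-segments : ∀ ws → concat (segments ws) ≡ catMaybes ws
  concat-segments ws = trans (concat-consNonEmpty (proj₁ (splitSegments ws)) _) (concat-split ws)
    where
    concat-split : ∀ ws →
      proj₁ (splitSegments ws) ++ concat (proj₂ (splitSegments ws)) ≡ catMaybes ws
    concat-split []             = refl
    concat-split (just a ∷ ws)  = cong (a ∷_) (concat-split ws)
    concat-split (nothing ∷ ws) =
      trans (concat-consNonEmpty (proj₁ (splitSegments ws)) _) (concat-split ws)

  segments-nonEmpty : ∀ ws → All NonEmpty (segments ws)
  segments-nonEmpty ws = All-consNonEmpty _ (λ ne → ne) (nonEmpty-split ws)
    where
    nonEmpty-split : ∀ ws → All NonEmpty (proj₂ (splitSegments ws))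
    nonEmpty-split []             = []
    nonEmpty-split (just _ ∷ ws)  = nonEmpty-split ws
    nonEmpty-split (nothing ∷ ws) = All-consNonEmpty _ (λ ne → ne) (nonEmpty-split ws)

  segments-linked : ∀ {R : A → A → Set} ws →
                    Linked (OnJusts R) ws → All (Linked R) (segments ws)
  segments-linked {R} ws l =
    All-consNonEmpty _ (λ _ → proj₁ (linked-split ws l)) (proj₂ (linked-split ws l))
    where
    linked-split : ∀ ws → Linked (OnJusts R) ws →
      Linked R (proj₁ (splitSegments ws)) × All (Linked R) (proj₂ (splitSegments ws))
    linked-split []                      _       = [] , []
    linked-split (just a ∷ [])           _       = [-] , []
    linked-split (just a ∷ nothing ∷ ws) (_ ∷ l) = [-] , proj₂ (linked-split (nothing ∷ ws) l)
    linked-split (just a ∷ just b ∷ ws)  (r ∷ l) = map₁ (r ∷_) (linked-split (just b ∷ ws) l)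
    linked-split (nothing ∷ ws)          l       =
      [] , All-consNonEmpty _ (λ _ → proj₁ (linked-split ws (Linked.tail l)))
                              (proj₂ (linked-split ws (Linked.tail l)))

  segmentEdges-segments : ∀ ws → segmentEdges (segments ws) ≡ adjacentJusts ws
  segmentEdges-segments ws = trans (segmentEdges-consNonEmpty (proj₁ (splitSegments ws)) _) (edges-split ws)
    where
    edges-split : ∀ ws → (length (proj₁ (splitSegments ws)) ∸ 1)
                         + segmentEdges (proj₂ (splitSegments ws)) ≡ adjacentJusts ws
    edges-split []                      = refl
    edges-split (just a ∷ [])           = refl
    edges-split (just a ∷ nothing ∷ ws) = edges-split (nothing ∷ ws)
    edges-split (just a ∷ just b ∷ ws)  = cong suc (edges-split (just b ∷ ws))
    edges-split (nothing ∷ ws)          =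
      trans (segmentEdges-consNonEmpty (proj₁ (splitSegments ws)) _)
            (trans (edges-split ws) (sym (adjacentJusts-nothing ws)))

segmentForest : ∀ {n} (H : Graph n) (ws : List (Maybe (Fin n))) →
                Linked (OnJusts (Adj H)) ws → catMaybes ws ↭ allFin n → SpanningLinearForest H
segmentForest H ws l p = record
  { paths    = segments ws
  ; nonempty = segments-nonEmpty ws
  ; isPath   = segments-linked ws l
  ; spanning = subst (_↭ allFin _) (sym (concat-segments ws)) p
  }

adjacentJusts≤π : ∀ {n} {H : Graph n} {π} → IsPi H π → (ws : List (Maybe (Fin n))) →
                  Linked (OnJusts (Adj H)) ws → catMaybes ws ↭ allFin n → adjacentJusts ws ≤ π
adjacentJusts≤π {H = H} {π} (_ , maximal) ws l p =
  subst (_≤ π) (segmentEdges-segments ws) (maximal (segmentForest H ws l p))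

module _ {A B : Set} (f : A → Maybe B) where

  ∈-mapMaybe⁺ : ∀ {x b} xs → x ∈ xs → f x ≡ just b → b ∈ mapMaybe f xs
  ∈-mapMaybe⁺ (x ∷ xs) (here refl) fx≡b rewrite fx≡b = here refl
  ∈-mapMaybe⁺ (y ∷ xs) (there x∈) fx≡b with f y
  ... | nothing = ∈-mapMaybe⁺ xs x∈ fx≡b
  ... | just _  = there (∈-mapMaybe⁺ xs x∈ fx≡b)

  ∈-mapMaybe⁻ : ∀ {b} xs → b ∈ mapMaybe f xs → ∃[ x ] x ∈ xs × f x ≡ just b
  ∈-mapMaybe⁻ (x ∷ xs) b∈ with f x in fx≡
  ∈-mapMaybe⁻ (x ∷ xs) (here refl) | just _ = x , here refl , fx≡
  ∈-mapMaybe⁻ (x ∷ xs) b∈          | nothing with ∈-mapMaybe⁻ xs b∈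
  ... | y , y∈ , fy = y , there y∈ , fy
  ∈-mapMaybe⁻ (x ∷ xs) (there b∈)  | just _  with ∈-mapMaybe⁻ xs b∈
  ... | y , y∈ , fy = y , there y∈ , fy

  mapMaybe-unique : (∀ {x y b} → f x ≡ just b → f y ≡ just b → x ≡ y) →
                    ∀ {xs} → Unique xs → Unique (mapMaybe f xs)
  mapMaybe-unique inj {[]}     []         = []
  mapMaybe-unique inj {x ∷ xs} (x∉ ∷ u) with f x in fx≡
  ... | nothing = mapMaybe-unique inj u
  ... | just b  = All.tabulate b∉ ∷ mapMaybe-unique inj u
    where
    b∉ : ∀ {b′} → b′ ∈ mapMaybe f xs → b ≢ b′
    b∉ b′∈ refl with ∈-mapMaybe⁻ xs b′∈
    ... | y , y∈ , fy = All.lookup x∉ y∈ (inj fx≡ fy)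

module _ {m n : ℕ} where

  inOddCopy : LexVertex m n → Bool
  inOddCopy (i , _) = oddPositionᵇ (toℕ i)

  restrict : Fin m → LexVertex m n → Maybe (Fin n)
  restrict i (j , v) with j ≟ i
  ... | yes _ = just v
  ... | no  _ = nothing

  layer : Fin m → List (LexVertex m n) → List (Fin n)
  layer i = mapMaybe (restrict i)

  restrict-self : ∀ i v → restrict i (i , v) ≡ just v
  restrict-self i v with i ≟ i
  ... | yes _  = refl
  ... | no i≢i = ⊥-elim (i≢i refl)

  restrict≡just : ∀ {i w} z → restrict i z ≡ just w → z ≡ (i , w)
  restrict≡just {i} (j , v) eq with j ≟ i
  restrict≡just (j , v) refl | yes refl = refl

  is-just-restrict : ∀ i z → is-just (restrict i z) ≡ does (proj₁ z ≟ i)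
  is-just-restrict i (j , v) with j ≟ i
  ... | yes _ = refl
  ... | no  _ = refl

  is-just-restrict-sameLayer : ∀ i c v v′ →
    is-just (restrict i (c , v)) ∧ is-just (restrict i (c , v′)) ≡ does (c ≟ i)
  is-just-restrict-sameLayer i c v v′ with c ≟ i
  ... | yes _ = refl
  ... | no  _ = refl

  layer-↭ : ∀ i {zs} → Unique zs → (∀ z → z ∈ zs) → layer i zs ↭ allFin n
  layer-↭ i {zs} unique covers = ∼bag⇒↭ (unique∧set⇒bag
    (mapMaybe-unique (restrict i) restrict-injective unique)
    (allFin⁺ n)
    (mk⇔ (λ _ → ∈-allFin _) (λ _ → ∈-mapMaybe⁺ (restrict i) zs (covers (i , _)) (restrict-self i _))))
    where
    restrict-injective : ∀ {z z′ w} → restrict i z ≡ just w → restrict i z′ ≡ just w → z ≡ z′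
    restrict-injective {z} {z′} p q = trans (restrict≡just z p) (sym (restrict≡just z′ q))

  length-layer-∷ : ∀ i z zs → length (layer i (z ∷ zs)) ≡ 𝟙 (does (proj₁ z ≟ i)) + length (layer i zs)
  length-layer-∷ i z zs =
    trans (length-catMaybes-∷ (restrict i z)) (cong (λ b → 𝟙 b + _) (is-just-restrict i z))
    where
    length-catMaybes-∷ : ∀ w → length (catMaybes (w ∷ map (restrict i) zs))
                               ≡ 𝟙 (is-just w) + length (layer i zs)
    length-catMaybes-∷ (just _) = refl
    length-catMaybes-∷ nothing  = refl

  sumAlt-length-layer : ∀ b zs → sumAlt b m (λ i → length (layer i zs)) ≡ count b (map inOddCopy zs)
  sumAlt-length-layer b []       = sumAlt-zero b m
  sumAlt-length-layer b (z ∷ zs) = begin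
    sumAlt b m (λ i → length (layer i (z ∷ zs)))
      ≡⟨ sumAlt-cong b m (λ i → length-layer-∷ i z zs) ⟩
    sumAlt b m (λ i → 𝟙 (does (proj₁ z ≟ i)) + length (layer i zs))
      ≡⟨ sumAlt-+ b m _ _ ⟩
    sumAlt b m (λ i → 𝟙 (does (proj₁ z ≟ i))) + sumAlt b m (λ i → length (layer i zs))
      ≡⟨ cong₂ _+_ (sumAlt-indicator b m (proj₁ z)) (sumAlt-length-layer b zs) ⟩
    count b (map inOddCopy (z ∷ zs)) ∎
    where open ≡-Reasoning

  module _ (Hs : Fin m → Graph n) where

    sameLayer-Adj : ∀ {i v v′} → LexAdj Hs (i , v) (i , v′) → Adj (Hs i) v v′
    sameLayer-Adj (inj₁ (_ , adj)) = adj
    sameLayer-Adj (inj₂ (inj₁ eq)) = ⊥-elim (1+n≢n (sym eq))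
    sameLayer-Adj (inj₂ (inj₂ eq)) = ⊥-elim (1+n≢n (sym eq))

    restrict-LexAdj : ∀ i {z z′} → LexAdj Hs z z′ → OnJusts (Adj (Hs i)) (restrict i z) (restrict i z′)
    restrict-LexAdj i {j , v} {j′ , v′} adj with j ≟ i | j′ ≟ i
    ... | yes refl | yes refl = sameLayer-Adj adj
    ... | yes _    | no _     = tt
    ... | no _     | _        = tt

    adjacentJusts-layer≤π : ∀ i {π} → IsPi (Hs i) π → ∀ {zs} → Linked (LexAdj Hs) zs →
      Unique zs → (∀ z → z ∈ zs) → adjacentJusts (map (restrict i) zs) ≤ π
    adjacentJusts-layer≤π i isPi {zs} l unique covers =
      adjacentJusts≤π isPi (map (restrict i) zs) (Linked-map⁺ (Linked.map (restrict-LexAdj i) l))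
                      (layer-↭ i unique covers)

    trueStep≤sumAlt : ∀ {z z′} → LexAdj Hs z z′ →
      𝟙 (inOddCopy z ∧ inOddCopy z′) ≤
      sumAlt true m (λ i → 𝟙 (is-just (restrict i z) ∧ is-just (restrict i z′)))
    trueStep≤sumAlt {c , v} {.c , v′} (inj₁ (refl , _)) = ≤-reflexive (begin
      𝟙 (oddPositionᵇ (toℕ c) ∧ oddPositionᵇ (toℕ c))
        ≡⟨ cong 𝟙 (∧-idem _) ⟩
      δ true (oddPositionᵇ (toℕ c))
        ≡⟨ sym (sumAlt-indicator true m c) ⟩
      sumAlt true m (λ i → 𝟙 (does (c ≟ i)))
        ≡⟨ sumAlt-cong true m (λ i → cong 𝟙 (sym (is-just-restrict-sameLayer i c v v′))) ⟩
      sumAlt true m (λ i → 𝟙 (is-just (restrict i (c , v)) ∧ is-just (restrict i (c , v′)))) ∎)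
      where open ≡-Reasoning
    trueStep≤sumAlt (inj₂ adj) = ≤-trans (≤-reflexive (cong 𝟙 (PathAdj⇒opposite adj))) z≤n

    trueSteps≤sumAlt-adjacentJusts : ∀ {zs} → Linked (LexAdj Hs) zs →
      trueSteps (map inOddCopy zs) ≤ sumAlt true m (λ i → adjacentJusts (map (restrict i) zs))
    trueSteps≤sumAlt-adjacentJusts []  = z≤n
    trueSteps≤sumAlt-adjacentJusts [-] = z≤n
    trueSteps≤sumAlt-adjacentJusts {z ∷ z′ ∷ zs} (adj ∷ l) =
      subst (𝟙 (inOddCopy z ∧ inOddCopy z′) + trueSteps (map inOddCopy (z′ ∷ zs)) ≤_)
            (sym (sumAlt-+ true m (λ i → 𝟙 (is-just (restrict i z) ∧ is-just (restrict i z′)))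
                                  (λ i → adjacentJusts (map (restrict i) (z′ ∷ zs)))))
            (+-mono-≤ (trueStep≤sumAlt adj) (trueSteps≤sumAlt-adjacentJusts l))

sumOddPositions-lowerBound : ∀ {k n} (Hs : Fin (suc (2 * k)) → Graph n) (πs : Fin (suc (2 * k)) → ℕ) →
  (∀ i → IsPi (Hs i) (πs i)) → ∀ {z w ps} → IsHamiltonianPath (LexAdj Hs) z w ps →
  𝟙 (not (inOddCopy z)) + 𝟙 (not (inOddCopy w)) + n ≤ suc (sumOddPositions (suc (2 * k)) πs)
sumOddPositions-lowerBound Hs πs isPi {ps = []} (_ , _ , _ , () , _)
sumOddPositions-lowerBound {k} {n} Hs πs isPi {z} {w} {ps = .z ∷ zs}
                           (linked , unique , covers , refl , last≡w) =
  +-cancelʳ-≤ F (h + t + n) (suc S) (begin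
    h + t + n + F
      ≡⟨ +-*-Solver.solve 4 (λ a b c d → a :+ b :+ c :+ d := a :+ (c :+ d) :+ b) refl h t n F ⟩
    h + (n + F) + t
      ≡⟨ cong₂ (λ T p → h + T + 𝟙 (not p)) (sym count-true) (sym lastOr≡w) ⟩
    h + count true bs + 𝟙 (not (lastOr (inOddCopy z) (map inOddCopy zs)))
      ≤⟨ count-true≤trueSteps+count-false (inOddCopy z) (map inOddCopy zs) ⟩
    suc (trueSteps bs + F)
      ≤⟨ s≤s (+-monoˡ-≤ F trueSteps≤S) ⟩
    suc (S + F) ∎)
  where
  open ≤-Reasoning
  open +-*-Solver using (_:+_; _:=_)
  m = suc (2 * k)
  S = sumOddPositions m πs
  bs = map inOddCopy (z ∷ zs)
  F = count false bs
  h = 𝟙 (not (inOddCopy z))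
  t = 𝟙 (not (inOddCopy w))

  lastOr≡w : lastOr (inOddCopy z) (map inOddCopy zs) ≡ inOddCopy w
  lastOr≡w = lastOr-map inOddCopy z zs last≡w

  count≡sumAlt : ∀ b → count b bs ≡ sumAlt b m (λ _ → n)
  count≡sumAlt b = trans (sym (sumAlt-length-layer b (z ∷ zs))) (sumAlt-cong b m (λ i →
    trans (↭-length (layer-↭ i unique covers)) (length-tabulate (λ j → j))))

  count-true : count true bs ≡ n + F
  count-true = trans (count≡sumAlt true) (trans (sumAlt-const-odd k n) (cong (n +_) (sym (count≡sumAlt false))))

  trueSteps≤S : trueSteps bs ≤ S
  trueSteps≤S = ≤-trans (trueSteps≤sumAlt-adjacentJusts Hs linked)
    (sumAlt-mono true m (λ i → adjacentJusts-layer≤π Hs i (isPi i) linked unique covers))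

lemma2 : (k n : ℕ) → 1 ≤ k →
    (Hs : Fin (suc (2 * k)) → Graph n) →
    (πs : Fin (suc (2 * k)) → ℕ) → (∀ i → IsPi (Hs i) (πs i)) →
    (ia ib : Fin (suc (2 * k))) → (x y : Fin n) →
    (ps : List (LexVertex (suc (2 * k)) n)) →
    IsHamiltonianPath (LexAdj Hs) (ia , x) (ib , y) ps →
    (Even (suc (toℕ ia)) → Even (suc (toℕ ib)) → suc n ≤ sumOddPositions (suc (2 * k)) πs)
    × (Odd (suc (toℕ ia)) → Even (suc (toℕ ib)) → n ≤ sumOddPositions (suc (2 * k)) πs)
    × (Odd (suc (toℕ ia)) → Odd (suc (toℕ ib)) → n ∸ 1 ≤ sumOddPositions (suc (2 * k)) πs)
lemma2 k n _ Hs πs isPi ia ib x y ps ham =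
    (λ a-even b-even → s≤s⁻¹ (bound (Even-suc⇒oddPositionᵇ a-even) (Even-suc⇒oddPositionᵇ b-even)))
  , (λ a-odd  b-even → s≤s⁻¹ (bound (Odd-suc⇒oddPositionᵇ a-odd) (Even-suc⇒oddPositionᵇ b-even)))
  , (λ a-odd  b-odd  → ∸-monoˡ-≤ 1 (bound (Odd-suc⇒oddPositionᵇ a-odd) (Odd-suc⇒oddPositionᵇ b-odd)))
  where
  bound : ∀ {p q} → oddPositionᵇ (toℕ ia) ≡ p → oddPositionᵇ (toℕ ib) ≡ q →
          𝟙 (not p) + 𝟙 (not q) + n ≤ suc (sumOddPositions (suc (2 * k)) πs)
  bound refl refl = sumOddPositions-lowerBound {k} Hs πs isPi ham
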